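{- Let $G$ be a graph, $k$ a positive integer, and $\mathcal{F}$ a layered family of $G$ with thickness at most $k$. Then for every $F\in\mathcal{F}$ and every $u,v\in F$, there exists a path in $G[F]$ from $u$ to $v$ that has at most $2k-1$ vertices, each of which is an ancestor of $u$ or of $v$.
   Context: Layered family: given an ordered partition $\Pi=(L_1,\dots,L_m)$ of $V(G)$, the layer digraph has an arc $(u,v)$ iff $uv\in E(G)$, $u\in L_i$, $v\in L_j$, $j<i$. $v$ is a descendant of $u$, and $u$ an ancestor of $v$, if there is a directed path from $u$ to $v$ in the layer digraph (every vertex is its own ancestor). For each vertex $u$ with no in-arcs, the set of $u$ and all its descendants belongs to $\mathcal{F}$. $\mathcal{F}$ is a layered family of $G$ if it arises this way from some ordered partition; its thickness is the smallest $k$ such that every member meets at most $k$ parts of $\Pi$. -}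

module Defs where

open import Data.Nat using (ℕ; _<_; _≤_)
open import Data.Fin using (Fin)
open import Data.List using (List; []; _∷_; length)
open import Data.List.Membership.Propositional using (_∈_)
open import Data.List.Relation.Unary.All using (All)
open import Data.List.Relation.Unary.Unique.Propositional using (Unique)
open import Data.Product using (∃; _×_)
open import Data.Sum using (_⊎_)
open import Relation.Nullary using (¬_)
open import Relation.Binary.Construct.Closure.ReflexiveTransitive using (Star)

record Graph (n : ℕ) : Set₁ where
  field
    Adj    : Fin n → Fin n → Set
    sym    : ∀ {x y} → Adj x y → Adj y x
    irrefl : ∀ {x} → ¬ Adj x x
open Graph public

-- An ordered partition (L_1,...,L_m) of V(G) is encoded by its layer
-- function: layer x = i  iff  x ∈ L_i.  (Empty parts are irrelevant.)
Layering : ℕ → Set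
Layering n = Fin n → ℕ

module _ {n : ℕ} (G : Graph n) (layer : Layering n) where

  Arc : Fin n → Fin n → Set
  Arc u v = Adj G u v × layer v < layer u

  -- v is a descendant of u (u an ancestor of v): directed path u ⇝ v
  Desc : Fin n → Fin n → Set
  Desc = Star Arc

  Source : Fin n → Set
  Source u = ∀ w → ¬ Arc w u

  -- Membership in the member F_r = {r} ∪ descendants of r (r a source)
  InMember : Fin n → Fin n → Set
  InMember r x = Desc r x

  -- Thickness at most k: every member F_r meets at most k parts,
  -- i.e. the layers of its vertices lie in a list of at most k values.
  ThicknessAtMost : ℕ → Set
  ThicknessAtMost k = ∀ r → Source r →
    ∃ λ (ls : List ℕ) → length ls ≤ k × (∀ x → Desc r x → layer x ∈ ls)

data Walk {n : ℕ} (G : Graph n) : Fin n → Fin n → Set where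
  [] : ∀ {u} → Walk G u u
  _∷_ : ∀ {u w v} → Adj G u w → Walk G w v → Walk G u v

vertices : ∀ {n} {G : Graph n} {u v} → Walk G u v → List (Fin n)
vertices {u = u} [] = u ∷ []
vertices {u = u} (_ ∷ p) = u ∷ vertices p

IsPath : ∀ {n} {G : Graph n} {u v} → Walk G u v → Set
IsPath p = Unique (vertices p)

-- A descendant chain r ⇝ x in the layer digraph strictly decreases the layer, so its vertices
-- lie in pairwise distinct layers, all met by F_r; thickness k therefore bounds its length by k.
-- Going up the chain from u to r and down the chain from r to v is a walk in G[F_r] with at
-- most 2k − 1 vertices, each an ancestor of u or of v, and removing its cycles leaves a path.
module Submission where

open import Defs
open import Data.Nat using (ℕ; _≤_; _*_; _∸_; NonZero; suc; _+_; _<_; s≤s; z≤n)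
open import Data.Nat.Properties
  using (≤-trans; <-trans; <⇒≢; +-mono-≤; +-suc; +-comm; +-identityʳ; module ≤-Reasoning)
open import Data.Fin using (Fin)
open import Data.Fin.Properties using () renaming (_≟_ to _≟ᶠ_)
open import Data.List using (List; []; _∷_; length; map)
open import Data.List.Properties using (length-map; length-removeAt′)
open import Data.List.Relation.Unary.All as All using (All; []; _∷_)
open import Data.List.Relation.Unary.All.Properties using (¬Any⇒All¬)
open import Data.List.Relation.Unary.Any using (here; there; _─_)
open import Data.List.Relation.Unary.AllPairs as AllPairs using ([]; _∷_)
open import Data.List.Relation.Unary.AllPairs.Properties as AllPairsₚ using ()
open import Data.List.Relation.Unary.Linked using (Linked; [-]; _∷_)
open import Data.List.Relation.Unary.Linked.Properties using (Linked⇒AllPairs)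
open import Data.List.Relation.Unary.Unique.Propositional using (Unique)
open import Data.List.Relation.Binary.Subset.Propositional using (_⊆_)
open import Data.List.Relation.Binary.Sublist.Propositional using (_∷_; _∷ʳ_; ⊆-refl; ⊆-trans)
  renaming (_⊆_ to _⊑_)
open import Data.List.Relation.Binary.Sublist.Propositional.Properties using (All-resp-⊆)
open import Data.List.Relation.Binary.Sublist.Heterogeneous.Properties using (length-mono-≤)
open import Data.List.Membership.Propositional using (_∈_)
open import Data.List.Membership.Propositional.Properties using (∈-map⁻)
open import Data.Product using (∃; _×_; _,_; proj₁; map₁; map₂)
open import Data.Sum using (_⊎_; inj₁; inj₂)
open import Data.Empty using (⊥-elim)
open import Function using (_∘_)
open import Relation.Nullary using (yes; no)
open import Relation.Binary.PropositionalEquality as ≡ using (_≡_; _≢_; refl; trans; cong; subst)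
open import Relation.Binary.Construct.Closure.ReflexiveTransitive using (ε; _◅_)

module _ {A : Set} where

  ∈-─⁺ : ∀ {x y : A} {ys} (x∈ys : x ∈ ys) → y ∈ ys → x ≢ y → y ∈ (ys ─ x∈ys)
  ∈-─⁺ (here refl)   (here refl)  x≢y = ⊥-elim (x≢y refl)
  ∈-─⁺ (here _)      (there y∈ys) _   = y∈ys
  ∈-─⁺ (there _)     (here y≡z)   _   = here y≡z
  ∈-─⁺ (there x∈ys) (there y∈ys) x≢y = there (∈-─⁺ x∈ys y∈ys x≢y)

  Unique-⊆⇒length-≤ : ∀ {xs ys : List A} → Unique xs → xs ⊆ ys → length xs ≤ length ys
  Unique-⊆⇒length-≤ {[]}     _          _     = z≤n
  Unique-⊆⇒length-≤ {x ∷ xs} {ys} (x∉xs ∷ u) xs⊆ys =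
    subst (suc (length xs) ≤_) (≡.sym (length-removeAt′ ys _))
      (s≤s (Unique-⊆⇒length-≤ u λ y∈xs →
        ∈-─⁺ x∈ys (xs⊆ys (there y∈xs)) (All.lookup x∉xs y∈xs)))
    where
    x∈ys : x ∈ ys
    x∈ys = xs⊆ys (here refl)

module _ {n : ℕ} {G : Graph n} where

  open import Data.List.Membership.DecPropositional (_≟ᶠ_ {n}) using (_∈?_)

  steps : ∀ {u v} → Walk G u v → ℕ
  steps []      = 0
  steps (_ ∷ p) = suc (steps p)

  length-vertices : ∀ {u v} (p : Walk G u v) → length (vertices p) ≡ suc (steps p)
  length-vertices []      = refl
  length-vertices (_ ∷ p) = cong suc (length-vertices p)

  _++ʷ_ : ∀ {u w v} → Walk G u w → Walk G w v → Walk G u v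
  []      ++ʷ q = q
  (e ∷ p) ++ʷ q = e ∷ (p ++ʷ q)

  reverseʷ : ∀ {u v} → Walk G u v → Walk G v u
  reverseʷ []      = []
  reverseʷ (e ∷ p) = reverseʷ p ++ʷ (Graph.sym G e ∷ [])

  steps-++ʷ : ∀ {u w v} (p : Walk G u w) (q : Walk G w v) → steps (p ++ʷ q) ≡ steps p + steps q
  steps-++ʷ []      q = refl
  steps-++ʷ (_ ∷ p) q = cong suc (steps-++ʷ p q)

  steps-reverseʷ : ∀ {u v} (p : Walk G u v) → steps (reverseʷ p) ≡ steps p
  steps-reverseʷ []      = refl
  steps-reverseʷ (e ∷ p) = trans (steps-++ʷ (reverseʷ p) _)
    (trans (cong (_+ 1) (steps-reverseʷ p)) (+-comm (steps p) 1))

  module _ {P : Fin n → Set} where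

    All-vertices-head : ∀ {u v} (p : Walk G u v) → All P (vertices p) → P u
    All-vertices-head []      (Pu ∷ _) = Pu
    All-vertices-head (_ ∷ _) (Pu ∷ _) = Pu

    All-vertices-++ʷ : ∀ {u w v} (p : Walk G u w) (q : Walk G w v) →
      All P (vertices p) → All P (vertices q) → All P (vertices (p ++ʷ q))
    All-vertices-++ʷ []      q _          Pq = Pq
    All-vertices-++ʷ (_ ∷ p) q (Pu ∷ Pp) Pq = Pu ∷ All-vertices-++ʷ p q Pp Pq

    All-vertices-reverseʷ : ∀ {u v} (p : Walk G u v) → All P (vertices p) → All P (vertices (reverseʷ p))
    All-vertices-reverseʷ []      Pp        = Pp
    All-vertices-reverseʷ (e ∷ p) (Pu ∷ Pp) = All-vertices-++ʷ (reverseʷ p) _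
      (All-vertices-reverseʷ p Pp) (All-vertices-head p Pp ∷ Pu ∷ [])

  suffixFrom : ∀ {u w v} (p : Walk G w v) → IsPath p → u ∈ vertices p →
    ∃ λ (q : Walk G u v) → IsPath q × vertices q ⊑ vertices p
  suffixFrom []      p-path (here refl)   = [] , p-path , ⊆-refl
  suffixFrom (e ∷ p) p-path (here refl)   = e ∷ p , p-path , ⊆-refl
  suffixFrom (e ∷ p) (_ ∷ p-path) (there u∈p) with suffixFrom p p-path u∈p
  ... | q , q-path , q⊑p = q , q-path , _ ∷ʳ q⊑p

  toPath : ∀ {u v} (p : Walk G u v) → ∃ λ (q : Walk G u v) → IsPath q × vertices q ⊑ vertices p
  toPath []      = [] , [] ∷ [] , ⊆-refl
  toPath {u} (e ∷ p) with toPath p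
  ... | q , q-path , q⊑p with u ∈? vertices q
  ...   | yes u∈q = let q′ , q′-path , q′⊑q = suffixFrom q q-path u∈q
                    in q′ , q′-path , _ ∷ʳ ⊆-trans q′⊑q q⊑p
  ...   | no  u∉q = e ∷ q , ¬Any⇒All¬ _ u∉q ∷ q-path , refl ∷ q⊑p

module _ {n : ℕ} {G : Graph n} {layer : Layering n} where

  chainWalk : ∀ {a b} → Desc G layer a b → Walk G a b
  chainWalk ε              = []
  chainWalk ((e , _) ◅ s) = e ∷ chainWalk s

  chainWalk-between : ∀ {a b} (s : Desc G layer a b) →
    All (λ x → Desc G layer a x × Desc G layer x b) (vertices (chainWalk s))
  chainWalk-between ε       = (ε , ε) ∷ []
  chainWalk-between (a ◅ s) = (ε , a ◅ s) ∷ All.map (map₁ (a ◅_)) (chainWalk-between s)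

  chainWalk-layer-decreasing : ∀ {a b} (s : Desc G layer a b) →
    Linked (λ x y → layer y < layer x) (vertices (chainWalk s))
  chainWalk-layer-decreasing ε                        = [-]
  chainWalk-layer-decreasing ((_ , lt) ◅ ε)           = lt ∷ [-]
  chainWalk-layer-decreasing ((_ , lt) ◅ s@(_ ◅ _)) = lt ∷ chainWalk-layer-decreasing s

  chainWalk-layers-unique : ∀ {a b} (s : Desc G layer a b) → Unique (map layer (vertices (chainWalk s)))
  chainWalk-layers-unique s = AllPairsₚ.map⁺ (AllPairs.map (λ lt → <⇒≢ lt ∘ ≡.sym)
    (Linked⇒AllPairs (λ p q → <-trans q p) (chainWalk-layer-decreasing s)))

  length-chainWalk-≤ : ∀ {k} → ThicknessAtMost G layer k → ∀ {r} → Source G layer r → ∀ {b}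
    (s : Desc G layer r b) → length (vertices (chainWalk s)) ≤ k
  length-chainWalk-≤ {k} thick {r} src s with thick r src
  ... | ls , ls≤k , layers∈ls = begin
    length (vertices (chainWalk s))             ≡⟨ length-map layer (vertices (chainWalk s)) ⟨
    length (map layer (vertices (chainWalk s))) ≤⟨ Unique-⊆⇒length-≤ (chainWalk-layers-unique s) layers⊆ls ⟩
    length ls                                   ≤⟨ ls≤k ⟩
    k                                           ∎
    where
    open ≤-Reasoning
    layers⊆ls : map layer (vertices (chainWalk s)) ⊆ ls
    layers⊆ls l∈ with ∈-map⁻ layer l∈
    ... | x , x∈ , refl = layers∈ls x (proj₁ (All.lookup (chainWalk-between s) x∈))

suc-+-≤-2*-∸1 : ∀ {a b k} → suc a ≤ k → suc b ≤ k → suc (a + b) ≤ 2 * k ∸ 1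
suc-+-≤-2*-∸1 {a} {b} {suc k} (s≤s a≤k) (s≤s b≤k) = begin
  suc (a + b)       ≡⟨ +-suc a b ⟨
  a + suc b         ≤⟨ +-mono-≤ a≤k (s≤s b≤k) ⟩
  k + suc k         ≡⟨ cong (λ m → k + suc m) (+-identityʳ k) ⟨
  2 * suc k ∸ 1     ∎
  where open ≤-Reasoning

lemma3p1 : ∀ {n} (G : Graph n) (k : ℕ) → .{{_ : NonZero k}} → (layer : Layering n) →
    ThicknessAtMost G layer k →
    ∀ r → Source G layer r → ∀ u v → InMember G layer r u → InMember G layer r v →
    ∃ λ (p : Walk G u v) → IsPath p
      × All (InMember G layer r) (vertices p)
      × length (vertices p) ≤ 2 * k ∸ 1
      × All (λ x → Desc G layer x u ⊎ Desc G layer x v) (vertices p)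
lemma3p1 G k layer thick r src u v r⇝u r⇝v =
  let p , p-path , p⊑w = toPath w
      inF , ancestral = All.unzip (All-resp-⊆ p⊑w w-good)
  in p , p-path , inF , ≤-trans (length-mono-≤ p⊑w) w-length , ancestral
  where
  up   = reverseʷ (chainWalk r⇝u)
  down = chainWalk r⇝v
  w    = up ++ʷ down

  w-good : All (λ x → InMember G layer r x × (Desc G layer x u ⊎ Desc G layer x v)) (vertices w)
  w-good = All-vertices-++ʷ up down
    (All-vertices-reverseʷ (chainWalk r⇝u) (All.map (map₂ inj₁) (chainWalk-between r⇝u)))
    (All.map (map₂ inj₂) (chainWalk-between r⇝v))

  bound : ∀ {b} (s : Desc G layer r b) → suc (steps (chainWalk s)) ≤ k
  bound s = subst (_≤ k) (length-vertices (chainWalk s)) (length-chainWalk-≤ thick src s)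

  w-length : length (vertices w) ≤ 2 * k ∸ 1
  w-length = begin
    length (vertices w)                       ≡⟨ length-vertices w ⟩
    suc (steps w)                             ≡⟨ cong suc (steps-++ʷ up down) ⟩
    suc (steps up + steps down)               ≡⟨ cong (λ m → suc (m + steps down)) (steps-reverseʷ _) ⟩
    suc (steps (chainWalk r⇝u) + steps down) ≤⟨ suc-+-≤-2*-∸1 (bound r⇝u) (bound r⇝v) ⟩
    2 * k ∸ 1                                 ∎
    where open ≤-Reasoning
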